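{- For every $R$, the following properties are equivalent: (1) $R^*=R^{\top*}$; (2) $R^+=R^{\top+}$; (3) $R^{\top}\subseteq R^*$; (4) $R^{\top}\subseteq R^+$; (5) $R\subseteq R^{\top*}$; (6) $R\subseteq R^{\top+}$; (7) $R^*\mathbin{;}R^{\top}\subseteq R^+$; (8) $R^{\top}\mathbin{;}R^*\subseteq R^+$. Each of them implies each of: (9) $R\mathbin{;}\mathsf{L}=R^{\top}\mathbin{;}\mathsf{L}$; (10) $R\mathbin{;}R^{\top}\subseteq R^+$; (11) $R^{\top}\mathbin{;}R\subseteq R^+$; (12) $R\mathbin{;}R^{\top}\mathbin{;}R^*\subseteq R^+$; (13) $R^*\mathbin{;}R^{\top}\mathbin{;}R\subseteq R^+$; (14) $R^*\mathbin{;}R\mathbin{;}R^{\top}\subseteq R^+$; (15) $R^{\top}\mathbin{;}R\mathbin{;}R^*\subseteq R^+$. If $R$ is univalent, each of (10), (12) and (14) is equivalent to (1). If $R$ is injective, each of (11), (13) and (15) is equivalent to (1).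
   Context: $(B,\cup,\mathbin{;},\overline{\,\cdot\,},{}^{\top},{}^{*},\mathsf{I})$ is a Kleene relation algebra; all variables range over $B$. That is, $(B,\cup,\mathbin{;},\overline{\,\cdot\,},{}^{\top},\mathsf{I})$ is a relation algebra: $\cup$ is associative and commutative and $R=\overline{\overline{R}\cup\overline{S}}\cup\overline{\overline{R}\cup S}$; $\mathbin{;}$ is associative, $(R\cup S)\mathbin{;}T=R\mathbin{;}T\cup S\mathbin{;}T$, $R\mathbin{;}\mathsf{I}=R$; $(R^{\top})^{\top}=R$, $(R\cup S)^{\top}=R^{\top}\cup S^{\top}$, $(R\mathbin{;}S)^{\top}=S^{\top}\mathbin{;}R^{\top}$; $R^{\top}\mathbin{;}\overline{R\mathbin{;}S}\cup\overline{S}=\overline{S}$. The order is $R\subseteq S$ iff $R\cup S=S$; $R\cap S=\overline{\overline{R}\cup\overline{S}}$; $\mathsf{L}=R\cup\overline{R}$ is the greatest and $\mathsf{O}=R\cap\overline{R}$ the least element. The star satisfies $\mathsf{I}\cup R\mathbin{;}R^*\subseteq R^*$, $\mathsf{I}\cup R^*\mathbin{;}R\subseteq R^*$, $S\cup R\mathbin{;}Q\subseteq Q\Rightarrow R^*\mathbin{;}S\subseteq Q$, $S\cup Q\mathbin{;}R\subseteq Q\Rightarrow S\mathbin{;}R^*\subseteq Q$. Write $R^+=R\mathbin{;}R^*$, $R^{\top*}=(R^{\top})^*$, $R^{\top+}=(R^{\top})^+$. The algebra satisfies the Tarski rule ($R\neq\mathsf{O}$ iff $\mathsf{L}\mathbin{;}R\mathbin{;}\mathsf{L}=\mathsf{L}$)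 and the point axiom (for every $R\neq\mathsf{O}$ there are points $p,q$ with $p\mathbin{;}q^{\top}\subseteq R$), where a point is an element $p$ with $p=p\mathbin{;}\mathsf{L}$, $p\mathbin{;}p^{\top}\subseteq\mathsf{I}$ and $\mathsf{I}\subseteq p^{\top}\mathbin{;}p$. Composition binds tighter than $\cup,\cap$; complement and converse bind tighter than composition. $R$ is univalent if $R^{\top}\mathbin{;}R\subseteq\mathsf{I}$ and injective if $R\mathbin{;}R^{\top}\subseteq\mathsf{I}$. -}

module Defs where

open import Relation.Binary.PropositionalEquality using (_≡_)
open import Relation.Nullary using (¬_)
open import Data.Product using (Σ; _×_; ∃)
open import Function.Bundles using (_⇔_)

record KleeneRelAlg : Set₁ where
  field
    B    : Set
    _∪_  : B → B → B
    _⨾_  : B → B → B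
    ∁    : B → B
    _ᵀ   : B → B
    _*   : B → B
    I    : B

  infixr 6 _∪_
  infixr 7 _⨾_

  infix 4 _⊆_
  _⊆_ : B → B → Set
  R ⊆ S = R ∪ S ≡ S

  _∩_ : B → B → B
  R ∩ S = ∁ (∁ R ∪ ∁ S)

  L : B
  L = I ∪ ∁ I

  O : B
  O = I ∩ ∁ I

  IsPoint : B → Set
  IsPoint p = (p ≡ p ⨾ L) × (p ⨾ (p ᵀ) ⊆ I) × (I ⊆ (p ᵀ) ⨾ p)

  field
    -- Boolean algebra part (Huntington axioms)
    ∪-assoc   : ∀ R S T → (R ∪ S) ∪ T ≡ R ∪ (S ∪ T)
    ∪-comm    : ∀ R S → R ∪ S ≡ S ∪ R
    huntington : ∀ R S → R ≡ ∁ (∁ R ∪ ∁ S) ∪ ∁ (∁ R ∪ S)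
    ⨾-assoc   : ∀ R S T → (R ⨾ S) ⨾ T ≡ R ⨾ (S ⨾ T)
    ⨾-distribʳ : ∀ R S T → (R ∪ S) ⨾ T ≡ R ⨾ T ∪ S ⨾ T
    ⨾-identityʳ : ∀ R → R ⨾ I ≡ R
    ᵀ-invol   : ∀ R → (R ᵀ) ᵀ ≡ R
    ᵀ-∪       : ∀ R S → (R ∪ S) ᵀ ≡ (R ᵀ) ∪ (S ᵀ)
    ᵀ-⨾       : ∀ R S → (R ⨾ S) ᵀ ≡ (S ᵀ) ⨾ (R ᵀ)
    schröder  : ∀ R S → (R ᵀ) ⨾ ∁ (R ⨾ S) ∪ ∁ S ≡ ∁ S
    star-unfoldˡ : ∀ R → I ∪ R ⨾ (R *) ⊆ R *
    star-unfoldʳ : ∀ R → I ∪ (R *) ⨾ R ⊆ R *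
    star-inductˡ : ∀ R S Q → S ∪ R ⨾ Q ⊆ Q → (R *) ⨾ S ⊆ Q
    star-inductʳ : ∀ R S Q → S ∪ Q ⨾ R ⊆ Q → S ⨾ (R *) ⊆ Q
    tarski    : ∀ R → (¬ (R ≡ O)) ⇔ (L ⨾ R ⨾ L ≡ L)
    point-axiom : ∀ R → ¬ (R ≡ O) →
                  Σ B λ p → Σ B λ q → IsPoint p × IsPoint q × (p ⨾ (q ᵀ) ⊆ R)

  _⁺ : B → B
  R ⁺ = R ⨾ (R *)

  Univalent : B → Set
  Univalent R = (R ᵀ) ⨾ R ⊆ I

  Injective : B → Set
  Injective R = R ⨾ (R ᵀ) ⊆ I

module Props (K : KleeneRelAlg) (R : KleeneRelAlg.B K) where
  open KleeneRelAlg K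
  P1 P2 P3 P4 P5 P6 P7 P8 P9 P10 P11 P12 P13 P14 P15 : Set
  P1  = R * ≡ (R ᵀ) *
  P2  = R ⁺ ≡ (R ᵀ) ⁺
  P3  = R ᵀ ⊆ R *
  P4  = R ᵀ ⊆ R ⁺
  P5  = R ⊆ (R ᵀ) *
  P6  = R ⊆ (R ᵀ) ⁺
  P7  = (R *) ⨾ (R ᵀ) ⊆ R ⁺
  P8  = (R ᵀ) ⨾ (R *) ⊆ R ⁺
  P9  = R ⨾ L ≡ (R ᵀ) ⨾ L
  P10 = R ⨾ (R ᵀ) ⊆ R ⁺
  P11 = (R ᵀ) ⨾ R ⊆ R ⁺
  P12 = R ⨾ (R ᵀ) ⨾ (R *) ⊆ R ⁺
  P13 = (R *) ⨾ (R ᵀ) ⨾ R ⊆ R ⁺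
  P14 = (R *) ⨾ R ⨾ (R ᵀ) ⊆ R ⁺
  P15 = (R ᵀ) ⨾ R ⨾ (R *) ⊆ R ⁺

-- Everything hinges on R ᵀ ⊆ R *. Since converse commutes with star, this is
-- equivalent to R ⊆ (R ᵀ) *, and star induction then gives R * = (R ᵀ) *. To
-- sharpen it to R ᵀ ⊆ R ⁺, note that R * = I ∪ R ⁺ takes care of the part of
-- R ᵀ off the diagonal, while R ᵀ ∩ I is a subidentity, hence symmetric, hence
-- contained in R. The remaining conditions differ from these only by factors
-- R * that R ⁺ absorbs. For univalent or injective R the converse implications
-- come from the Dedekind consequence R ᵀ ⊆ R ᵀ ⨾ R ⨾ R ᵀ. The Boolean laws are
-- derived from Huntington's axiom; idempotence of ∪ comes from Schröder's rule.

module Submission where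

open import Algebra.Bundles using (CommutativeSemigroup)
import Algebra.Properties.CommutativeSemigroup as CommutativeSemigroupProperties
open import Data.Product using (_×_; _,_)
open import Defs
open import Function.Base using (_∘_)
open import Function.Bundles using (_⇔_; mk⇔; Equivalence)
open import Function.Construct.Composition using (_⇔-∘_)
open import Function.Construct.Symmetry using (⇔-sym)
open import Level using (0ℓ)
open import Relation.Binary.Bundles using (Poset)
open import Relation.Binary.PropositionalEquality
  using (_≡_; refl; sym; trans; cong; cong₂; subst; isEquivalence; module ≡-Reasoning)
import Relation.Binary.Reasoning.PartialOrder as PosetReasoning
open import Relation.Binary.Structures using (IsPartialOrder)

module KleeneRelAlgLaws (K : KleeneRelAlg) where
  open KleeneRelAlg K
  open ≡-Reasoning

  private
    ∪-commutativeSemigroup : CommutativeSemigroup 0ℓ 0ℓ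
    ∪-commutativeSemigroup = record
      { Carrier = B
      ; _≈_ = _≡_
      ; _∙_ = _∪_
      ; isCommutativeSemigroup = record
        { isSemigroup = record
          { isMagma = record { isEquivalence = isEquivalence ; ∙-cong = cong₂ _∪_ }
          ; assoc = ∪-assoc
          }
        ; comm = ∪-comm
        }
      }

  open CommutativeSemigroupProperties ∪-commutativeSemigroup
    using (interchange; xy∙z≈y∙xz)

  ᵀ-I : I ᵀ ≡ I
  ᵀ-I = begin
    I ᵀ              ≡⟨ ⨾-identityʳ (I ᵀ) ⟨
    I ᵀ ⨾ I          ≡⟨ cong (I ᵀ ⨾_) (ᵀ-invol I) ⟨
    I ᵀ ⨾ (I ᵀ) ᵀ    ≡⟨ ᵀ-⨾ (I ᵀ) I ⟨
    (I ᵀ ⨾ I) ᵀ      ≡⟨ cong _ᵀ (⨾-identityʳ (I ᵀ)) ⟩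
    (I ᵀ) ᵀ          ≡⟨ ᵀ-invol I ⟩
    I                ∎

  ⨾-identityˡ : ∀ R → I ⨾ R ≡ R
  ⨾-identityˡ R = begin
    I ⨾ R            ≡⟨ ᵀ-invol (I ⨾ R) ⟨
    ((I ⨾ R) ᵀ) ᵀ    ≡⟨ cong _ᵀ (ᵀ-⨾ I R) ⟩
    (R ᵀ ⨾ I ᵀ) ᵀ    ≡⟨ cong (λ S → (R ᵀ ⨾ S) ᵀ) ᵀ-I ⟩
    (R ᵀ ⨾ I) ᵀ      ≡⟨ cong _ᵀ (⨾-identityʳ (R ᵀ)) ⟩
    (R ᵀ) ᵀ          ≡⟨ ᵀ-invol R ⟩
    R                ∎

  ⨾-distribˡ : ∀ R S T → R ⨾ (S ∪ T) ≡ R ⨾ S ∪ R ⨾ T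
  ⨾-distribˡ R S T = begin
    R ⨾ (S ∪ T)                    ≡⟨ ᵀ-invol _ ⟨
    ((R ⨾ (S ∪ T)) ᵀ) ᵀ            ≡⟨ cong _ᵀ (ᵀ-⨾ R (S ∪ T)) ⟩
    ((S ∪ T) ᵀ ⨾ R ᵀ) ᵀ            ≡⟨ cong (λ U → (U ⨾ R ᵀ) ᵀ) (ᵀ-∪ S T) ⟩
    ((S ᵀ ∪ T ᵀ) ⨾ R ᵀ) ᵀ          ≡⟨ cong _ᵀ (⨾-distribʳ (S ᵀ) (T ᵀ) (R ᵀ)) ⟩
    (S ᵀ ⨾ R ᵀ ∪ T ᵀ ⨾ R ᵀ) ᵀ      ≡⟨ ᵀ-∪ _ _ ⟩
    (S ᵀ ⨾ R ᵀ) ᵀ ∪ (T ᵀ ⨾ R ᵀ) ᵀ  ≡⟨ cong₂ _∪_ (ᵀ-ᵀ⨾ᵀ R S) (ᵀ-ᵀ⨾ᵀ R T) ⟩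
    R ⨾ S ∪ R ⨾ T                  ∎
    where
    ᵀ-ᵀ⨾ᵀ : ∀ U V → (V ᵀ ⨾ U ᵀ) ᵀ ≡ U ⨾ V
    ᵀ-ᵀ⨾ᵀ U V = trans (ᵀ-⨾ (V ᵀ) (U ᵀ)) (cong₂ _⨾_ (ᵀ-invol U) (ᵀ-invol V))

  ∪-idem-∁ : ∀ R → ∁ R ∪ ∁ R ≡ ∁ R
  ∪-idem-∁ R = begin
    ∁ R ∪ ∁ R                ≡⟨ cong (_∪ ∁ R) I⨾∁I⨾R ⟨
    I ᵀ ⨾ ∁ (I ⨾ R) ∪ ∁ R    ≡⟨ schröder I R ⟩
    ∁ R                      ∎
    where
    I⨾∁I⨾R : I ᵀ ⨾ ∁ (I ⨾ R) ≡ ∁ R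
    I⨾∁I⨾R = trans (cong₂ (λ S T → S ⨾ ∁ T) ᵀ-I (⨾-identityˡ R)) (⨾-identityˡ (∁ R))

  -- Huntington's axiom writes every element as a join of complements.
  ∪-idem : ∀ R → R ∪ R ≡ R
  ∪-idem R = begin
    R ∪ R                        ≡⟨ cong₂ _∪_ h h ⟩
    (∁ a ∪ ∁ b) ∪ (∁ a ∪ ∁ b)    ≡⟨ interchange (∁ a) (∁ b) (∁ a) (∁ b) ⟩
    (∁ a ∪ ∁ a) ∪ (∁ b ∪ ∁ b)    ≡⟨ cong₂ _∪_ (∪-idem-∁ a) (∪-idem-∁ b) ⟩
    ∁ a ∪ ∁ b                    ≡⟨ h ⟨
    R                            ∎
    where
    a = ∁ R ∪ ∁ R
    b = ∁ R ∪ R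
    h = huntington R R

  ∪-absorb : ∀ R S → R ∪ (R ∪ S) ≡ R ∪ S
  ∪-absorb R S = trans (sym (∪-assoc R R S)) (cong (_∪ S) (∪-idem R))

  huntington-self : ∀ R → R ≡ ∁ (∁ R) ∪ ∁ (∁ R ∪ R)
  huntington-self R = trans (huntington R R) (cong (λ S → ∁ S ∪ ∁ (∁ R ∪ R)) (∪-idem (∁ R)))

  huntington-∁ : ∀ R → R ≡ ∁ (∁ R ∪ ∁ (∁ R)) ∪ ∁ (∁ R)
  huntington-∁ R =
    trans (huntington R (∁ R)) (cong (λ S → ∁ (∁ R ∪ ∁ (∁ R)) ∪ ∁ S) (∪-idem (∁ R)))

  ∪-∁≡∁∪∁∁ : ∀ R → R ∪ ∁ R ≡ ∁ R ∪ ∁ (∁ R)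
  ∪-∁≡∁∪∁∁ R = begin
    R ∪ ∁ R                ≡⟨ cong (_∪ ∁ R) (huntington-∁ R) ⟩
    (Y ∪ ∁ (∁ R)) ∪ ∁ R    ≡⟨ xy∙z≈y∙xz Y (∁ (∁ R)) (∁ R) ⟩
    ∁ (∁ R) ∪ (Y ∪ ∁ R)    ≡⟨ cong (∁ (∁ R) ∪_) Y∪∁R≡∁R ⟩
    ∁ (∁ R) ∪ ∁ R          ≡⟨ ∪-comm _ _ ⟩
    ∁ R ∪ ∁ (∁ R)          ∎
    where
    Y = ∁ (∁ R ∪ ∁ (∁ R))

    ∁R≡∁∁∁R∪Y : ∁ R ≡ ∁ (∁ (∁ R)) ∪ Y
    ∁R≡∁∁∁R∪Y = trans (huntington-self (∁ R))
                      (cong (λ S → ∁ (∁ (∁ R)) ∪ ∁ S) (∪-comm (∁ (∁ R)) (∁ R)))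

    Y∪∁R≡∁R : Y ∪ ∁ R ≡ ∁ R
    Y∪∁R≡∁R = begin
      Y ∪ ∁ R                  ≡⟨ cong (Y ∪_) ∁R≡∁∁∁R∪Y ⟩
      Y ∪ (∁ (∁ (∁ R)) ∪ Y)    ≡⟨ cong (Y ∪_) (∪-comm _ Y) ⟩
      Y ∪ (Y ∪ ∁ (∁ (∁ R)))    ≡⟨ ∪-absorb Y _ ⟩
      Y ∪ ∁ (∁ (∁ R))          ≡⟨ ∪-comm Y _ ⟩
      ∁ (∁ (∁ R)) ∪ Y          ≡⟨ ∁R≡∁∁∁R∪Y ⟨
      ∁ R                      ∎

  ∁-involutive : ∀ R → ∁ (∁ R) ≡ R
  ∁-involutive R = begin
    ∁ (∁ R)              ≡⟨ ∁∁R≡z∪W ⟩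
    z ∪ W                ≡⟨ ∪-absorb z W ⟨
    z ∪ (z ∪ W)          ≡⟨ ∪-comm z (z ∪ W) ⟩
    (z ∪ W) ∪ z          ≡⟨ cong (_∪ z) ∁∁R≡z∪W ⟨
    ∁ (∁ R) ∪ z          ≡⟨ R≡∁∁R∪z ⟨
    R                    ∎
    where
    z = ∁ (R ∪ ∁ R)
    W = ∁ (∁ (∁ (∁ R)) ∪ ∁ R)

    R≡∁∁R∪z : R ≡ ∁ (∁ R) ∪ z
    R≡∁∁R∪z = trans (huntington-self R) (cong (λ S → ∁ (∁ R) ∪ ∁ S) (∪-comm (∁ R) R))

    ∁∁∁R∪∁∁R≡R∪∁R : ∁ (∁ (∁ R)) ∪ ∁ (∁ R) ≡ R ∪ ∁ R
    ∁∁∁R∪∁∁R≡R∪∁R = sym (begin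
      R ∪ ∁ R                    ≡⟨ ∪-∁≡∁∪∁∁ R ⟩
      ∁ R ∪ ∁ (∁ R)              ≡⟨ ∪-∁≡∁∪∁∁ (∁ R) ⟩
      ∁ (∁ R) ∪ ∁ (∁ (∁ R))      ≡⟨ ∪-comm _ _ ⟩
      ∁ (∁ (∁ R)) ∪ ∁ (∁ R)      ∎)

    ∁∁R≡z∪W : ∁ (∁ R) ≡ z ∪ W
    ∁∁R≡z∪W = trans (huntington (∁ (∁ R)) (∁ R)) (cong (λ S → ∁ S ∪ W) ∁∁∁R∪∁∁R≡R∪∁R)

  -- Huntington's axiom splits R ∪ ∁ R into four parts symmetric in R and S.
  ∪-∁-invariant : ∀ R S → R ∪ ∁ R ≡ S ∪ ∁ S
  ∪-∁-invariant R S = begin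
    R ∪ ∁ R                                                       ≡⟨ quadrants R S ⟩
    (∁ (∁ R ∪ ∁ S) ∪ ∁ (∁ R ∪ S)) ∪ (∁ (R ∪ ∁ S) ∪ ∁ (R ∪ S))     ≡⟨ interchange _ _ _ _ ⟩
    (∁ (∁ R ∪ ∁ S) ∪ ∁ (R ∪ ∁ S)) ∪ (∁ (∁ R ∪ S) ∪ ∁ (R ∪ S))     ≡⟨ cong₂ _∪_
                                                                       (cong₂ _∪_ (∁-∪-comm (∁ R) (∁ S)) (∁-∪-comm R (∁ S)))
                                                                       (cong₂ _∪_ (∁-∪-comm (∁ R) S) (∁-∪-comm R S)) ⟩
    (∁ (∁ S ∪ ∁ R) ∪ ∁ (∁ S ∪ R)) ∪ (∁ (S ∪ ∁ R) ∪ ∁ (S ∪ R))     ≡⟨ quadrants S R ⟨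
    S ∪ ∁ S                                                       ∎
    where
    quadrants : ∀ U V → U ∪ ∁ U ≡ (∁ (∁ U ∪ ∁ V) ∪ ∁ (∁ U ∪ V)) ∪ (∁ (U ∪ ∁ V) ∪ ∁ (U ∪ V))
    quadrants U V = cong₂ _∪_ (huntington U V)
      (trans (huntington (∁ U) V)
             (cong (λ X → ∁ (X ∪ ∁ V) ∪ ∁ (X ∪ V)) (∁-involutive U)))

    ∁-∪-comm : ∀ U V → ∁ (U ∪ V) ≡ ∁ (V ∪ U)
    ∁-∪-comm U V = cong ∁ (∪-comm U V)

  ∩-partition : ∀ R S → R ≡ (R ∩ S) ∪ (R ∩ ∁ S)
  ∩-partition R S =
    trans (huntington R S) (cong (λ T → (R ∩ S) ∪ ∁ (∁ R ∪ T)) (sym (∁-involutive S)))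

  ⊆-trans : ∀ {R S T} → R ⊆ S → S ⊆ T → R ⊆ T
  ⊆-trans {R} {S} {T} R⊆S S⊆T = begin
    R ∪ T          ≡⟨ cong (R ∪_) S⊆T ⟨
    R ∪ (S ∪ T)    ≡⟨ ∪-assoc R S T ⟨
    (R ∪ S) ∪ T    ≡⟨ cong (_∪ T) R⊆S ⟩
    S ∪ T          ≡⟨ S⊆T ⟩
    T              ∎

  ⊆-antisym : ∀ {R S} → R ⊆ S → S ⊆ R → R ≡ S
  ⊆-antisym {R} {S} R⊆S S⊆R = begin
    R        ≡⟨ S⊆R ⟨
    S ∪ R    ≡⟨ ∪-comm S R ⟩
    R ∪ S    ≡⟨ R⊆S ⟩
    S        ∎

  ⊆-isPartialOrder : IsPartialOrder _≡_ _⊆_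
  ⊆-isPartialOrder = record
    { isPreorder = record
      { isEquivalence = isEquivalence
      ; reflexive = λ { {R} refl → ∪-idem R }
      ; trans = ⊆-trans
      }
    ; antisym = ⊆-antisym
    }

  ⊆-poset : Poset 0ℓ 0ℓ 0ℓ
  ⊆-poset = record { isPartialOrder = ⊆-isPartialOrder }

module KleeneRelAlgProperties (K : KleeneRelAlg) where
  open KleeneRelAlg K
  open KleeneRelAlgLaws K
  open PosetReasoning ⊆-poset

  ⊆-refl : ∀ {R} → R ⊆ R
  ⊆-refl {R} = ∪-idem R

  ⊆-reflexive : ∀ {R S} → R ≡ S → R ⊆ S
  ⊆-reflexive refl = ⊆-refl

  ⊆-∪ˡ : ∀ {R S} → R ⊆ R ∪ S
  ⊆-∪ˡ {R} {S} = ∪-absorb R S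

  ⊆-∪ʳ : ∀ {R S} → S ⊆ R ∪ S
  ⊆-∪ʳ {R} {S} = subst (S ⊆_) (∪-comm S R) ⊆-∪ˡ

  ∪-least : ∀ {R S T} → R ⊆ T → S ⊆ T → R ∪ S ⊆ T
  ∪-least {R} {S} {T} R⊆T S⊆T = trans (∪-assoc R S T) (trans (cong (R ∪_) S⊆T) R⊆T)

  ∪-mono : ∀ {R S T U} → R ⊆ T → S ⊆ U → R ∪ S ⊆ T ∪ U
  ∪-mono R⊆T S⊆U = ∪-least (⊆-trans R⊆T ⊆-∪ˡ) (⊆-trans S⊆U ⊆-∪ʳ)

  ⊆-L : ∀ R → R ⊆ L
  ⊆-L R = ⊆-trans ⊆-∪ˡ (⊆-reflexive (∪-∁-invariant R I))

  ∁-antitone : ∀ {R S} → R ⊆ S → ∁ S ⊆ ∁ R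
  ∁-antitone {R} {S} R⊆S = begin
    ∁ S                                    ≤⟨ ⊆-∪ʳ ⟩
    ∁ (R ∪ ∁ S) ∪ ∁ S                      ≡⟨ cong (λ T → ∁ (R ∪ ∁ S) ∪ ∁ T) R⊆S ⟨
    ∁ (R ∪ ∁ S) ∪ ∁ (R ∪ S)                ≡⟨ cong (λ T → ∁ (T ∪ ∁ S) ∪ ∁ (T ∪ S)) (∁-involutive R) ⟨
    ∁ (∁ (∁ R) ∪ ∁ S) ∪ ∁ (∁ (∁ R) ∪ S)    ≡⟨ huntington (∁ R) S ⟨
    ∁ R                                    ∎

  ∩-comm : ∀ R S → R ∩ S ≡ S ∩ R
  ∩-comm R S = cong ∁ (∪-comm (∁ R) (∁ S))

  ∩-⊆ˡ : ∀ {R S} → R ∩ S ⊆ R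
  ∩-⊆ˡ {R} {S} = begin
    R ∩ S                  ≤⟨ ⊆-∪ˡ ⟩
    (R ∩ S) ∪ (R ∩ ∁ S)    ≡⟨ ∩-partition R S ⟨
    R                      ∎

  ∩-⊆ʳ : ∀ {R S} → R ∩ S ⊆ S
  ∩-⊆ʳ {R} {S} = subst (_⊆ S) (∩-comm S R) ∩-⊆ˡ

  ∩-greatest : ∀ {R S T} → T ⊆ R → T ⊆ S → T ⊆ R ∩ S
  ∩-greatest {R} {S} {T} T⊆R T⊆S = begin
    T          ≡⟨ ∁-involutive T ⟨
    ∁ (∁ T)    ≤⟨ ∁-antitone (∪-least (∁-antitone T⊆R) (∁-antitone T⊆S)) ⟩
    R ∩ S      ∎

  ∩-mono : ∀ {R S T U} → R ⊆ T → S ⊆ U → R ∩ S ⊆ T ∩ U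
  ∩-mono R⊆T S⊆U = ∩-greatest (⊆-trans ∩-⊆ˡ R⊆T) (⊆-trans ∩-⊆ʳ S⊆U)

  [R∪S]∩∁R⊆S : ∀ R S → (R ∪ S) ∩ ∁ R ⊆ S
  [R∪S]∩∁R⊆S R S = begin
    (R ∪ S) ∩ ∁ R        ≡⟨ cong ∁ (trans (∪-comm _ _) (cong (_∪ ∁ (R ∪ S)) (∁-involutive R))) ⟩
    ∁ (R ∪ ∁ (R ∪ S))    ≤⟨ ∁-antitone ∁S⊆R∪∁[R∪S] ⟩
    ∁ (∁ S)              ≡⟨ ∁-involutive S ⟩
    S                    ∎
    where
    ∁S⊆R∪∁[R∪S] : ∁ S ⊆ R ∪ ∁ (R ∪ S)
    ∁S⊆R∪∁[R∪S] = begin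
      ∁ S                            ≡⟨ ∩-partition (∁ S) R ⟩
      (∁ S ∩ R) ∪ (∁ S ∩ ∁ R)        ≡⟨ cong (λ T → (∁ S ∩ R) ∪ ∁ T) (cong₂ _∪_ (∁-involutive S) (∁-involutive R)) ⟩
      (∁ S ∩ R) ∪ ∁ (S ∪ R)          ≤⟨ ∪-mono ∩-⊆ʳ (⊆-reflexive (cong ∁ (∪-comm S R))) ⟩
      R ∪ ∁ (R ∪ S)                  ∎

  [R∪S]∩T⊆R : ∀ {R S T} → S ⊆ ∁ T → (R ∪ S) ∩ T ⊆ R
  [R∪S]∩T⊆R {R} {S} {T} S⊆∁T = begin
    (R ∪ S) ∩ T            ≤⟨ ∩-mono (∪-mono ⊆-refl S⊆∁T) ⊆-refl ⟩
    (R ∪ ∁ T) ∩ T          ≡⟨ cong₂ _∩_ (∪-comm R (∁ T)) (sym (∁-involutive T)) ⟩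
    (∁ T ∪ R) ∩ ∁ (∁ T)    ≤⟨ [R∪S]∩∁R⊆S (∁ T) R ⟩
    R                      ∎

  ⨾-monoˡ : ∀ {R S T} → R ⊆ S → R ⨾ T ⊆ S ⨾ T
  ⨾-monoˡ {R} {S} {T} R⊆S = trans (sym (⨾-distribʳ R S T)) (cong (_⨾ T) R⊆S)

  ⨾-monoʳ : ∀ {R S T} → R ⊆ S → T ⨾ R ⊆ T ⨾ S
  ⨾-monoʳ {R} {S} {T} R⊆S = trans (sym (⨾-distribˡ T R S)) (cong (T ⨾_) R⊆S)

  ᵀ-mono : ∀ {R S} → R ⊆ S → R ᵀ ⊆ S ᵀ
  ᵀ-mono {R} {S} R⊆S = trans (sym (ᵀ-∪ R S)) (cong _ᵀ R⊆S)

  ᵀ⊆⇔⊆ᵀ : ∀ {R S} → R ᵀ ⊆ S ⇔ R ⊆ S ᵀ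
  ᵀ⊆⇔⊆ᵀ {R} {S} = mk⇔ (subst (_⊆ S ᵀ) (ᵀ-invol R) ∘ ᵀ-mono) (subst (R ᵀ ⊆_) (ᵀ-invol S) ∘ ᵀ-mono)

  dedekind : ∀ Q R S → (Q ⨾ R) ∩ S ⊆ Q ⨾ (R ∩ (Q ᵀ ⨾ S))
  dedekind Q R S = begin
    (Q ⨾ R) ∩ S                                        ≡⟨ cong (_∩ S) Q⨾R-split ⟩
    (Q ⨾ (R ∩ (Q ᵀ ⨾ S)) ∪ Q ⨾ (R ∩ ∁ (Q ᵀ ⨾ S))) ∩ S  ≤⟨ [R∪S]∩T⊆R outside-S ⟩
    Q ⨾ (R ∩ (Q ᵀ ⨾ S))                                ∎
    where
    Q⨾R-split : Q ⨾ R ≡ Q ⨾ (R ∩ (Q ᵀ ⨾ S)) ∪ Q ⨾ (R ∩ ∁ (Q ᵀ ⨾ S))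
    Q⨾R-split = trans (cong (Q ⨾_) (∩-partition R (Q ᵀ ⨾ S))) (⨾-distribˡ Q _ _)

    outside-S : Q ⨾ (R ∩ ∁ (Q ᵀ ⨾ S)) ⊆ ∁ S
    outside-S = begin
      Q ⨾ (R ∩ ∁ (Q ᵀ ⨾ S))          ≤⟨ ⨾-monoʳ ∩-⊆ʳ ⟩
      Q ⨾ ∁ (Q ᵀ ⨾ S)                ≡⟨ cong (_⨾ ∁ (Q ᵀ ⨾ S)) (ᵀ-invol Q) ⟨
      (Q ᵀ) ᵀ ⨾ ∁ (Q ᵀ ⨾ S)          ≤⟨ schröder (Q ᵀ) S ⟩
      ∁ S                            ∎

  ⊆⨾ᵀ⨾ : ∀ R → R ⊆ R ⨾ (R ᵀ ⨾ R)
  ⊆⨾ᵀ⨾ R = begin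
    R                       ≤⟨ ∩-greatest ⊆-refl ⊆-refl ⟩
    R ∩ R                   ≡⟨ cong (_∩ R) (⨾-identityʳ R) ⟨
    (R ⨾ I) ∩ R             ≤⟨ dedekind R I R ⟩
    R ⨾ (I ∩ (R ᵀ ⨾ R))     ≤⟨ ⨾-monoʳ ∩-⊆ʳ ⟩
    R ⨾ (R ᵀ ⨾ R)           ∎

  ⊆I⇒⊆ᵀ : ∀ {R} → R ⊆ I → R ⊆ R ᵀ
  ⊆I⇒⊆ᵀ {R} R⊆I = begin
    R                  ≤⟨ ⊆⨾ᵀ⨾ R ⟩
    R ⨾ (R ᵀ ⨾ R)      ≤⟨ ⨾-monoˡ R⊆I ⟩
    I ⨾ (R ᵀ ⨾ R)      ≡⟨ ⨾-identityˡ _ ⟩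
    R ᵀ ⨾ R            ≤⟨ ⨾-monoʳ R⊆I ⟩
    R ᵀ ⨾ I            ≡⟨ ⨾-identityʳ _ ⟩
    R ᵀ                ∎

  I⊆* : ∀ R → I ⊆ R *
  I⊆* R = ⊆-trans ⊆-∪ˡ (star-unfoldˡ R)

  ⁺⊆* : ∀ R → R ⁺ ⊆ R *
  ⁺⊆* R = ⊆-trans ⊆-∪ʳ (star-unfoldˡ R)

  *⨾⊆* : ∀ R → R * ⨾ R ⊆ R *
  *⨾⊆* R = ⊆-trans ⊆-∪ʳ (star-unfoldʳ R)

  ⊆⨾* : ∀ R S → S ⊆ S ⨾ R *
  ⊆⨾* R S = begin
    S          ≡⟨ ⨾-identityʳ S ⟨
    S ⨾ I      ≤⟨ ⨾-monoʳ (I⊆* R) ⟩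
    S ⨾ R *    ∎

  ⊆*⨾ : ∀ R S → S ⊆ R * ⨾ S
  ⊆*⨾ R S = begin
    S          ≡⟨ ⨾-identityˡ S ⟨
    I ⨾ S      ≤⟨ ⨾-monoˡ (I⊆* R) ⟩
    R * ⨾ S    ∎

  ⊆⁺ : ∀ R → R ⊆ R ⁺
  ⊆⁺ R = ⊆⨾* R R

  ⊆* : ∀ R → R ⊆ R *
  ⊆* R = ⊆-trans (⊆⁺ R) (⁺⊆* R)

  *-least : ∀ {R S} → I ⊆ S → R ⨾ S ⊆ S → R * ⊆ S
  *-least {R} {S} I⊆S R⨾S⊆S = begin
    R *        ≡⟨ ⨾-identityʳ (R *) ⟨
    R * ⨾ I    ≤⟨ star-inductˡ R I S (∪-least I⊆S R⨾S⊆S) ⟩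
    S          ∎

  *⨾*⊆* : ∀ R → R * ⨾ R * ⊆ R *
  *⨾*⊆* R = star-inductˡ R (R *) (R *) (∪-least ⊆-refl (⁺⊆* R))

  *⨾⁺⊆⁺ : ∀ R → R * ⨾ R ⁺ ⊆ R ⁺
  *⨾⁺⊆⁺ R = star-inductˡ R (R ⁺) (R ⁺) (∪-least ⊆-refl (⨾-monoʳ (⁺⊆* R)))

  ⁺⨾*⊆⁺ : ∀ R → R ⁺ ⨾ R * ⊆ R ⁺
  ⁺⨾*⊆⁺ R = begin
    (R ⨾ R *) ⨾ R *    ≡⟨ ⨾-assoc R (R *) (R *) ⟩
    R ⨾ (R * ⨾ R *)    ≤⟨ ⨾-monoʳ (*⨾*⊆* R) ⟩
    R ⨾ R *            ∎

  *⨾≡⁺ : ∀ R → R * ⨾ R ≡ R ⁺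
  *⨾≡⁺ R = ⊆-antisym
    (star-inductˡ R R (R ⁺) (∪-least (⊆⁺ R) (⨾-monoʳ (⁺⊆* R))))
    (star-inductʳ R R (R * ⨾ R) (∪-least (⊆*⨾ R R) (⨾-monoˡ (*⨾⊆* R))))

  *-unfold : ∀ R → R * ≡ I ∪ R ⁺
  *-unfold R = ⊆-antisym
    (*-least ⊆-∪ˡ (⊆-trans (⨾-monoʳ (star-unfoldˡ R)) ⊆-∪ʳ))
    (star-unfoldˡ R)

  ⊆*⇒*⊆* : ∀ {R S} → S ⊆ R * → S * ⊆ R *
  ⊆*⇒*⊆* {R} {S} S⊆R* = *-least (I⊆* R) (⊆-trans (⨾-monoˡ S⊆R*) (*⨾*⊆* R))

  ⊆⁺⇒⁺⊆⁺ : ∀ {R S} → S ⊆ R ⁺ → S ⁺ ⊆ R ⁺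
  ⊆⁺⇒⁺⊆⁺ {R} {S} S⊆R⁺ = begin
    S ⨾ S *      ≤⟨ ⨾-monoˡ S⊆R⁺ ⟩
    R ⁺ ⨾ S *    ≤⟨ ⨾-monoʳ (⊆*⇒*⊆* (⊆-trans S⊆R⁺ (⁺⊆* R))) ⟩
    R ⁺ ⨾ R *    ≤⟨ ⁺⨾*⊆⁺ R ⟩
    R ⁺          ∎

  ᵀ-*⊆ : ∀ R → (R *) ᵀ ⊆ (R ᵀ) *
  ᵀ-*⊆ R = Equivalence.from ᵀ⊆⇔⊆ᵀ (*-least I⊆[Rᵀ*]ᵀ R⨾[Rᵀ*]ᵀ⊆[Rᵀ*]ᵀ)
    where
    I⊆[Rᵀ*]ᵀ : I ⊆ ((R ᵀ) *) ᵀ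
    I⊆[Rᵀ*]ᵀ = subst (_⊆ ((R ᵀ) *) ᵀ) ᵀ-I (ᵀ-mono (I⊆* (R ᵀ)))

    R⨾[Rᵀ*]ᵀ⊆[Rᵀ*]ᵀ : R ⨾ ((R ᵀ) *) ᵀ ⊆ ((R ᵀ) *) ᵀ
    R⨾[Rᵀ*]ᵀ⊆[Rᵀ*]ᵀ = begin
      R ⨾ ((R ᵀ) *) ᵀ           ≡⟨ cong (_⨾ ((R ᵀ) *) ᵀ) (ᵀ-invol R) ⟨
      (R ᵀ) ᵀ ⨾ ((R ᵀ) *) ᵀ     ≡⟨ ᵀ-⨾ ((R ᵀ) *) (R ᵀ) ⟨
      ((R ᵀ) * ⨾ R ᵀ) ᵀ         ≤⟨ ᵀ-mono (*⨾⊆* (R ᵀ)) ⟩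
      ((R ᵀ) *) ᵀ               ∎

  ᵀ-* : ∀ R → (R *) ᵀ ≡ (R ᵀ) *
  ᵀ-* R = ⊆-antisym (ᵀ-*⊆ R) (Equivalence.to ᵀ⊆⇔⊆ᵀ (begin
    ((R ᵀ) *) ᵀ      ≤⟨ ᵀ-*⊆ (R ᵀ) ⟩
    ((R ᵀ) ᵀ) *      ≡⟨ cong _* (ᵀ-invol R) ⟩
    R *              ∎))

  ᵀ-⁺ : ∀ R → (R ⁺) ᵀ ≡ (R ᵀ) ⁺
  ᵀ-⁺ R = begin-equality
    (R ⨾ R *) ᵀ          ≡⟨ ᵀ-⨾ R (R *) ⟩
    (R *) ᵀ ⨾ R ᵀ        ≡⟨ cong (_⨾ R ᵀ) (ᵀ-* R) ⟩
    (R ᵀ) * ⨾ R ᵀ        ≡⟨ *⨾≡⁺ (R ᵀ) ⟩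
    (R ᵀ) ⁺              ∎

  ⊆*∧∩I⊆⁺⇒⊆⁺ : ∀ {R S} → S ⊆ R * → S ∩ I ⊆ R ⁺ → S ⊆ R ⁺
  ⊆*∧∩I⊆⁺⇒⊆⁺ {R} {S} S⊆R* S∩I⊆R⁺ = begin
    S                        ≡⟨ ∩-partition S I ⟩
    (S ∩ I) ∪ (S ∩ ∁ I)      ≤⟨ ∪-least S∩I⊆R⁺ off-diagonal ⟩
    R ⁺                      ∎
    where
    off-diagonal : S ∩ ∁ I ⊆ R ⁺
    off-diagonal = begin
      S ∩ ∁ I            ≤⟨ ∩-mono S⊆R* ⊆-refl ⟩
      (R *) ∩ ∁ I        ≡⟨ cong (_∩ ∁ I) (*-unfold R) ⟩
      (I ∪ R ⁺) ∩ ∁ I    ≤⟨ [R∪S]∩∁R⊆S I (R ⁺) ⟩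
      R ⁺                ∎

  -- The diagonal part of R ᵀ is symmetric, hence contained in R.
  ᵀ⊆*⇔ᵀ⊆⁺ : ∀ {R} → R ᵀ ⊆ R * ⇔ R ᵀ ⊆ R ⁺
  ᵀ⊆*⇔ᵀ⊆⁺ {R} = mk⇔ (λ Rᵀ⊆R* → ⊆*∧∩I⊆⁺⇒⊆⁺ Rᵀ⊆R* diagonal) (λ Rᵀ⊆R⁺ → ⊆-trans Rᵀ⊆R⁺ (⁺⊆* R))
    where
    diagonal : (R ᵀ) ∩ I ⊆ R ⁺
    diagonal = begin
      (R ᵀ) ∩ I             ≤⟨ ⊆I⇒⊆ᵀ ∩-⊆ʳ ⟩
      ((R ᵀ) ∩ I) ᵀ         ≤⟨ ᵀ-mono ∩-⊆ˡ ⟩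
      (R ᵀ) ᵀ               ≡⟨ ᵀ-invol R ⟩
      R                     ≤⟨ ⊆⁺ R ⟩
      R ⁺                   ∎

  ᵀ⊆*⇔⊆ᵀ* : ∀ {R} → R ᵀ ⊆ R * ⇔ R ⊆ (R ᵀ) *
  ᵀ⊆*⇔⊆ᵀ* {R} = subst (λ S → R ᵀ ⊆ R * ⇔ R ⊆ S) (ᵀ-* R) ᵀ⊆⇔⊆ᵀ

  ᵀ⊆⁺⇔⊆ᵀ⁺ : ∀ {R} → R ᵀ ⊆ R ⁺ ⇔ R ⊆ (R ᵀ) ⁺
  ᵀ⊆⁺⇔⊆ᵀ⁺ {R} = subst (λ S → R ᵀ ⊆ R ⁺ ⇔ R ⊆ S) (ᵀ-⁺ R) ᵀ⊆⇔⊆ᵀ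

  *≡ᵀ*⇔ᵀ⊆* : ∀ {R} → R * ≡ (R ᵀ) * ⇔ R ᵀ ⊆ R *
  *≡ᵀ*⇔ᵀ⊆* {R} = mk⇔
    (λ R*≡Rᵀ* → subst (R ᵀ ⊆_) (sym R*≡Rᵀ*) (⊆* (R ᵀ)))
    (λ Rᵀ⊆R* → ⊆-antisym (⊆*⇒*⊆* (Equivalence.to ᵀ⊆*⇔⊆ᵀ* Rᵀ⊆R*)) (⊆*⇒*⊆* Rᵀ⊆R*))

  *≡ᵀ*⇔⁺≡ᵀ⁺ : ∀ {R} → R * ≡ (R ᵀ) * ⇔ R ⁺ ≡ (R ᵀ) ⁺
  *≡ᵀ*⇔⁺≡ᵀ⁺ {R} = mk⇔
    (λ R*≡Rᵀ* → let Rᵀ⊆R⁺ = Equivalence.to (ᵀ⊆*⇔ᵀ⊆⁺ ⇔-∘ *≡ᵀ*⇔ᵀ⊆*) R*≡Rᵀ* in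
      ⊆-antisym (⊆⁺⇒⁺⊆⁺ (Equivalence.to ᵀ⊆⁺⇔⊆ᵀ⁺ Rᵀ⊆R⁺)) (⊆⁺⇒⁺⊆⁺ Rᵀ⊆R⁺))
    (λ R⁺≡Rᵀ⁺ → begin-equality
      R *              ≡⟨ *-unfold R ⟩
      I ∪ R ⁺          ≡⟨ cong (I ∪_) R⁺≡Rᵀ⁺ ⟩
      I ∪ (R ᵀ) ⁺      ≡⟨ *-unfold (R ᵀ) ⟨
      (R ᵀ) *          ∎)

  *⨾⊆⁺⇔⊆⁺ : ∀ {R S} → R * ⨾ S ⊆ R ⁺ ⇔ S ⊆ R ⁺
  *⨾⊆⁺⇔⊆⁺ {R} {S} = mk⇔
    (⊆-trans (⊆*⨾ R S))
    (λ S⊆R⁺ → ⊆-trans (⨾-monoʳ S⊆R⁺) (*⨾⁺⊆⁺ R))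

  ⨾*⊆⁺⇔⊆⁺ : ∀ {R S} → S ⨾ R * ⊆ R ⁺ ⇔ S ⊆ R ⁺
  ⨾*⊆⁺⇔⊆⁺ {R} {S} = mk⇔
    (⊆-trans (⊆⨾* R S))
    (λ S⊆R⁺ → ⊆-trans (⨾-monoˡ S⊆R⁺) (⁺⨾*⊆⁺ R))

  ⨾⨾*⊆⁺⇔⨾⊆⁺ : ∀ {R S T} → S ⨾ T ⨾ R * ⊆ R ⁺ ⇔ S ⨾ T ⊆ R ⁺
  ⨾⨾*⊆⁺⇔⨾⊆⁺ {R} {S} {T} = subst (λ U → U ⊆ R ⁺ ⇔ S ⨾ T ⊆ R ⁺) (⨾-assoc S T (R *)) ⨾*⊆⁺⇔⊆⁺

  ⊆⁺⇒⨾L⊆⨾L : ∀ {R S} → S ⊆ R ⁺ → S ⨾ L ⊆ R ⨾ L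
  ⊆⁺⇒⨾L⊆⨾L {R} {S} S⊆R⁺ = begin
    S ⨾ L              ≤⟨ ⨾-monoˡ S⊆R⁺ ⟩
    (R ⨾ R *) ⨾ L      ≡⟨ ⨾-assoc R (R *) L ⟩
    R ⨾ (R * ⨾ L)      ≤⟨ ⨾-monoʳ (⊆-L (R * ⨾ L)) ⟩
    R ⨾ L              ∎

  ᵀ⊆⁺⇒⨾L≡ᵀ⨾L : ∀ {R} → R ᵀ ⊆ R ⁺ → R ⨾ L ≡ R ᵀ ⨾ L
  ᵀ⊆⁺⇒⨾L≡ᵀ⨾L Rᵀ⊆R⁺ = ⊆-antisym (⊆⁺⇒⨾L⊆⨾L (Equivalence.to ᵀ⊆⁺⇔⊆ᵀ⁺ Rᵀ⊆R⁺)) (⊆⁺⇒⨾L⊆⨾L Rᵀ⊆R⁺)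

  ᵀ⊆*⇒ᵀ⨾⊆⁺ : ∀ {R} → R ᵀ ⊆ R * → R ᵀ ⨾ R ⊆ R ⁺
  ᵀ⊆*⇒ᵀ⨾⊆⁺ {R} Rᵀ⊆R* = ⊆-trans (⨾-monoˡ Rᵀ⊆R*) (⊆-reflexive (*⨾≡⁺ R))

  univalent⇒⨾ᵀ⊆⁺⇔ᵀ⊆* : ∀ {R} → Univalent R → R ⨾ R ᵀ ⊆ R ⁺ ⇔ R ᵀ ⊆ R *
  univalent⇒⨾ᵀ⊆⁺⇔ᵀ⊆* {R} RᵀR⊆I = mk⇔ (λ RRᵀ⊆R⁺ → begin
      R ᵀ                        ≤⟨ ⊆⨾ᵀ⨾ (R ᵀ) ⟩
      R ᵀ ⨾ ((R ᵀ) ᵀ ⨾ R ᵀ)      ≡⟨ cong (λ S → R ᵀ ⨾ (S ⨾ R ᵀ)) (ᵀ-invol R) ⟩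
      R ᵀ ⨾ (R ⨾ R ᵀ)            ≤⟨ ⨾-monoʳ RRᵀ⊆R⁺ ⟩
      R ᵀ ⨾ (R ⨾ R *)            ≡⟨ ⨾-assoc (R ᵀ) R (R *) ⟨
      (R ᵀ ⨾ R) ⨾ R *            ≤⟨ ⨾-monoˡ RᵀR⊆I ⟩
      I ⨾ R *                    ≡⟨ ⨾-identityˡ (R *) ⟩
      R *                        ∎)
    ⨾-monoʳ

  injective⇒ᵀ⨾⊆⁺⇔ᵀ⊆* : ∀ {R} → Injective R → R ᵀ ⨾ R ⊆ R ⁺ ⇔ R ᵀ ⊆ R *
  injective⇒ᵀ⨾⊆⁺⇔ᵀ⊆* {R} RRᵀ⊆I = mk⇔ (λ RᵀR⊆R⁺ → begin
      R ᵀ                        ≤⟨ ⊆⨾ᵀ⨾ (R ᵀ) ⟩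
      R ᵀ ⨾ ((R ᵀ) ᵀ ⨾ R ᵀ)      ≡⟨ cong (λ S → R ᵀ ⨾ (S ⨾ R ᵀ)) (ᵀ-invol R) ⟩
      R ᵀ ⨾ (R ⨾ R ᵀ)            ≡⟨ ⨾-assoc (R ᵀ) R (R ᵀ) ⟨
      (R ᵀ ⨾ R) ⨾ R ᵀ            ≤⟨ ⨾-monoˡ RᵀR⊆R⁺ ⟩
      R ⁺ ⨾ R ᵀ                  ≡⟨ cong (_⨾ R ᵀ) (*⨾≡⁺ R) ⟨
      (R * ⨾ R) ⨾ R ᵀ            ≡⟨ ⨾-assoc (R *) R (R ᵀ) ⟩
      R * ⨾ (R ⨾ R ᵀ)            ≤⟨ ⨾-monoʳ RRᵀ⊆I ⟩
      R * ⨾ I                    ≡⟨ ⨾-identityʳ (R *) ⟩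
      R *                        ∎)
    ᵀ⊆*⇒ᵀ⨾⊆⁺

mainTheorem8 : (K : KleeneRelAlg) (R : KleeneRelAlg.B K) →
    let open KleeneRelAlg K
        open Props K R
    in ((P1 ⇔ P2) × (P1 ⇔ P3) × (P1 ⇔ P4) × (P1 ⇔ P5) × (P1 ⇔ P6) × (P1 ⇔ P7) × (P1 ⇔ P8))
       × (P1 → P9 × P10 × P11 × P12 × P13 × P14 × P15)
       × (Univalent R → (P10 ⇔ P1) × (P12 ⇔ P1) × (P14 ⇔ P1))
       × (Injective R → (P11 ⇔ P1) × (P13 ⇔ P1) × (P15 ⇔ P1))
mainTheorem8 K R =
    ( *≡ᵀ*⇔⁺≡ᵀ⁺ , p1⇔p3 , p1⇔p4 , ᵀ⊆*⇔⊆ᵀ* ⇔-∘ p1⇔p3 , ᵀ⊆⁺⇔⊆ᵀ⁺ ⇔-∘ p1⇔p4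
    , ⇔-sym *⨾⊆⁺⇔⊆⁺ ⇔-∘ p1⇔p4 , ⇔-sym ⨾*⊆⁺⇔⊆⁺ ⇔-∘ p1⇔p4 )
  , (λ p1 → let p3 = to p1⇔p3 p1
                p10 = ⨾-monoʳ p3
                p11 = ᵀ⊆*⇒ᵀ⨾⊆⁺ p3
            in ᵀ⊆⁺⇒⨾L≡ᵀ⨾L (to p1⇔p4 p1) , p10 , p11
             , from ⨾⨾*⊆⁺⇔⨾⊆⁺ p10 , from *⨾⊆⁺⇔⊆⁺ p11 , from *⨾⊆⁺⇔⊆⁺ p10 , from ⨾⨾*⊆⁺⇔⨾⊆⁺ p11)
  , (λ univalent → let p10⇔p1 = ⇔-sym p1⇔p3 ⇔-∘ univalent⇒⨾ᵀ⊆⁺⇔ᵀ⊆* univalent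
                   in p10⇔p1 , p10⇔p1 ⇔-∘ ⨾⨾*⊆⁺⇔⨾⊆⁺ , p10⇔p1 ⇔-∘ *⨾⊆⁺⇔⊆⁺)
  , (λ injective → let p11⇔p1 = ⇔-sym p1⇔p3 ⇔-∘ injective⇒ᵀ⨾⊆⁺⇔ᵀ⊆* injective
                   in p11⇔p1 , p11⇔p1 ⇔-∘ *⨾⊆⁺⇔⊆⁺ , p11⇔p1 ⇔-∘ ⨾⨾*⊆⁺⇔⨾⊆⁺)
  where
  open KleeneRelAlg K
  open Props K R
  open KleeneRelAlgProperties K
  open Equivalence using (to; from)

  p1⇔p3 : P1 ⇔ P3
  p1⇔p3 = *≡ᵀ*⇔ᵀ⊆*

  p1⇔p4 : P1 ⇔ P4
  p1⇔p4 = ᵀ⊆*⇔ᵀ⊆⁺ ⇔-∘ p1⇔p3
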